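{- Let $G$ be a directed multigraph. Then: (1) The directed multigraph obtained from $G$ by reversing all of its arcs has the same hike dependency graph as $G$ (up to isomorphism). (2) If $v_1\neq v_2$ are vertices of $G$ such that every arc leaving $v_1$ points to $v_2$, then the directed multigraph obtained from $G$ by jumping $v_1$ has the same hike dependency graph as $G$. (3) If $v_1\neq v_2$ are vertices of $G$ such that every arc entering $v_2$ comes from $v_1$, then the directed multigraph obtained from $G$ by jumping $v_2$ has the same hike dependency graph as $G$.
   Context: A directed multigraph has a finite vertex set and a finite multiset of arcs (loops and multiple arcs allowed). A simple cycle is a closed sequence of arcs $(i_0,i_1)_{k_1}\cdots(i_{\ell-1},i_0)_{k_\ell}$, $\ell\ge1$, with all $i_t$ distinct, considered up to cyclic rotation (orientation and the specific arcs used matter; a self-loop is a simple cycle of length one). The hike dependency graph $\phi(G)$ is the simple graph whose vertices are the simple cycles of $G$, two distinct simple cycles being adjacent iff they share a vertex of $G$ (having isomorphic hike dependency graphs is equivalent to having isomorphic hike monoids). Reversing an arc $(a,b)$ means replacing it by $(b,a)$. Jumping a vertex $v$ means deleting $v$ (with its incident arcs) and adding one arc $(a,b)$ for each pair consisting of an arc $(a,v)$ and an arc $(v,b)$ of $G$. -}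

module Defs where

open import Data.Nat using (ℕ; suc)
open import Data.Fin using (Fin; punchOut; _≟_)
open import Data.Product using (Σ; ∃; ∃-syntax; _×_; _,_; proj₁; proj₂; swap)
open import Data.List using (List; []; _∷_; _++_; [_]; map; length; lookup; drop; take; concatMap)
open import Data.List.Membership.Propositional using (_∈_)
open import Data.List.Relation.Unary.Linked using (Linked)
open import Data.List.Relation.Unary.Unique.Propositional using (Unique)
open import Relation.Nullary using (¬_; yes; no)
open import Relation.Binary.PropositionalEquality using (_≡_)

-- A directed multigraph on the vertex set Fin n.  The multiset of arcs is
-- a list of (tail , head) pairs; an individual arc is a position in the list
-- (so parallel arcs are distinguished).
record Digraph (n : ℕ) : Set where
  constructor digraph
  field
    arcs : List (Fin n × Fin n)

open Digraph public

Arc : ∀ {n} → Digraph n → Set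
Arc G = Fin (length (arcs G))

src tgt : ∀ {n} (G : Digraph n) → Arc G → Fin n
src G e = proj₁ (lookup (arcs G) e)
tgt G e = proj₂ (lookup (arcs G) e)

-- A simple cycle, represented by one of its rotations: a nonempty list of
-- arcs e₀ e₁ … e_{ℓ-1} with head(e_t) = tail(e_{t+1}) and head(e_{ℓ-1}) = tail(e₀),
-- whose tails i₀ … i_{ℓ-1} are pairwise distinct.
record SimpleCycle {n} (G : Digraph n) : Set where
  constructor cycle
  field
    first  : Arc G
    rest   : List (Arc G)
    closed : Linked (λ e f → tgt G e ≡ src G f) (first ∷ rest ++ [ first ])
    simple : Unique (map (src G) (first ∷ rest))

open SimpleCycle public

arcList : ∀ {n} {G : Digraph n} → SimpleCycle G → List (Arc G)
arcList c = first c ∷ rest c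

vertices : ∀ {n} {G : Digraph n} → SimpleCycle G → List (Fin n)
vertices {G = G} c = map (src G) (arcList c)

_≈C_ : ∀ {n} {G : Digraph n} → SimpleCycle G → SimpleCycle G → Set
c ≈C d = ∃[ k ] arcList d ≡ drop k (arcList c) ++ take k (arcList c)

Adjφ : ∀ {n} (G : Digraph n) → SimpleCycle G → SimpleCycle G → Set
Adjφ G c d = ¬ (c ≈C d) × (∃[ v ] (v ∈ vertices c × v ∈ vertices d))

record φIso {n m} (G : Digraph n) (H : Digraph m) : Set where
  field
    to       : SimpleCycle G → SimpleCycle H
    from     : SimpleCycle H → SimpleCycle G
    to-cong   : ∀ {c d} → c ≈C d → to c ≈C to d
    from-cong : ∀ {c d} → c ≈C d → from c ≈C from d
    from-to  : ∀ c → from (to c) ≈C c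
    to-from  : ∀ d → to (from d) ≈C d
    adj-to   : ∀ c d → Adjφ G c d → Adjφ H (to c) (to d)
    adj-from : ∀ c d → Adjφ H (to c) (to d) → Adjφ G c d

reverseAll : ∀ {n} → Digraph n → Digraph n
reverseAll G = digraph (map swap (arcs G))

-- Arcs not incident to v are kept; for each arc
-- (a , v) and each arc (v , b) an arc (a , b) is added.  (Loops at v are not
-- paired: in the situations of Proposition 5 there are none.)
module _ {n : ℕ} (v : Fin (suc n)) where
  keepArc : Fin (suc n) × Fin (suc n) → List (Fin n × Fin n)
  keepArc (a , b) with v ≟ a | v ≟ b
  ... | no v≢a | no v≢b = [ (punchOut v≢a , punchOut v≢b) ]
  ... | _      | _      = []

  inArc : Fin (suc n) × Fin (suc n) → List (Fin n)
  inArc (a , b) with v ≟ a | v ≟ b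
  ... | no v≢a | yes _ = [ punchOut v≢a ]
  ... | _      | _     = []

  outArc : Fin (suc n) × Fin (suc n) → List (Fin n)
  outArc (a , b) with v ≟ a | v ≟ b
  ... | yes _ | no v≢b = [ punchOut v≢b ]
  ... | _     | _      = []

  jump : Digraph (suc n) → Digraph n
  jump G = digraph
    (concatMap keepArc (arcs G) ++
     concatMap (λ x → concatMap (λ y → concatMap (λ a → map (λ b → (a , b)) (outArc y)) (inArc x))
                                (arcs G))
               (arcs G))

module Submission where

-- Reversing the arcs of a simple cycle gives a simple cycle of the reversed graph on the
-- same vertices, and reversing twice is the identity.
--
-- For jumping v, where every arc out of v ends at w (or every arc into v starts at w),
-- every arc of the jumped graph is either an arc of G avoiding v or the merge of an arc
-- into v with an arc out of v. A simple cycle of G, rotated so as not to start at v,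
-- compresses to a simple cycle of the jumped graph by merging the at most one pair of
-- arcs through v; conversely, expanding the merged arcs of a simple cycle of the jumped
-- graph gives a simple cycle of G: all merged arcs end at w (start at w), so there is at
-- most one of them and v is visited at most once. Sharing of vertices is preserved because
-- a cycle through v also passes through w ≠ v.

open import Defs
open import Data.Empty using (⊥; ⊥-elim)
open import Data.Fin using (Fin; zero; suc; punchIn; punchOut; _≟_)
open import Data.Fin.Properties using (punchIn-punchOut; punchInᵢ≢i; punchIn-injective; suc-injective)
open import Data.List using (List; []; _∷_; _++_; [_]; map; length; lookup; drop; take; reverse; concatMap)
open import Data.List.Properties
  using ( ∷-injective; ++-assoc; ++-identityʳ; map-++; map-∘; map-cong; map-id; concatMap-++; take++drop≡id
        ; reverse-++; reverse-map; reverse-involutive; unfold-reverse )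
open import Data.List.Membership.Propositional using (_∈_; _∉_)
open import Data.List.Membership.Propositional.Properties using (∈-++⁺ʳ; ∈-map⁺; ∈-map⁻; ∈-lookup)
open import Data.List.Relation.Binary.Permutation.Propositional using (_↭_; ↭-sym; ↭-trans; prep; ↭⇒↭ₛ)
open import Data.List.Relation.Binary.Permutation.Propositional.Properties
  using (∈-resp-↭; ↭-reverse; ++-comm; ∷↭∷ʳ)
import Data.List.Relation.Binary.Permutation.Propositional.Properties as ↭
import Data.List.Relation.Binary.Permutation.Setoid.Properties as ↭ₛ
open import Data.List.Relation.Unary.All as All using (All; []; _∷_)
import Data.List.Relation.Unary.All.Properties as All
open import Data.List.Relation.Unary.AllPairs as AllPairs using ([]; _∷_)
open import Data.List.Relation.Unary.Any using (here; there)
open import Data.List.Relation.Unary.Linked as Linked using (Linked; []; [-]; _∷_)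
import Data.List.Relation.Unary.Linked.Properties as Linked
open import Data.List.Relation.Unary.Unique.Propositional using (Unique)
import Data.List.Relation.Unary.Unique.Propositional.Properties as Unique
open import Data.Nat using (ℕ; suc)
open import Data.Product using (Σ; ∃-syntax; ∃₂; _×_; _,_; proj₁; proj₂; swap)
open import Data.Sum using (_⊎_; inj₁; inj₂; [_,_]′; map₂)
open import Data.Unit using (⊤; tt)
open import Function using (_on_; flip)
open import Relation.Nullary using (¬_; Dec; yes; no; ¬?; _×-dec_)
open import Relation.Binary.PropositionalEquality
  using (_≡_; _≢_; refl; sym; trans; cong; cong₂; subst; subst₂; setoid; module ≡-Reasoning)

private variable
  A B : Set
  n m : ℕ

-- Rotations and cyclically linked lists

Rotation : List A → List A → Set
Rotation xs ys = ∃₂ λ as bs → xs ≡ as ++ bs × ys ≡ bs ++ as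

rotation-refl : ∀ (xs : List A) → Rotation xs xs
rotation-refl xs = [] , xs , refl , sym (++-identityʳ xs)

rotation-sym : ∀ {xs ys : List A} → Rotation xs ys → Rotation ys xs
rotation-sym (as , bs , p , q) = bs , as , q , p

++-overlap : ∀ (as bs cs ds : List A) → as ++ bs ≡ cs ++ ds →
  (Σ (List A) λ ms → as ≡ cs ++ ms × ds ≡ ms ++ bs) ⊎ (Σ (List A) λ ms → cs ≡ as ++ ms × bs ≡ ms ++ ds)
++-overlap []       bs cs       ds eq = inj₂ (cs , refl , eq)
++-overlap (a ∷ as) bs []       ds eq = inj₁ (a ∷ as , refl , sym eq)
++-overlap (a ∷ as) bs (c ∷ cs) ds eq with ∷-injective eq
... | refl , eq′ with ++-overlap as bs cs ds eq′
...   | inj₁ (ms , p , q) = inj₁ (ms , cong (a ∷_) p , q)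
...   | inj₂ (ms , p , q) = inj₂ (ms , cong (a ∷_) p , q)

rotation-trans : ∀ {xs ys zs : List A} → Rotation xs ys → Rotation ys zs → Rotation xs zs
rotation-trans (as , bs , p , q) (cs , ds , q′ , r) with ++-overlap bs as cs ds (trans (sym q) q′)
... | inj₁ (ms , refl , refl) = as ++ cs , ms , trans p (sym (++-assoc as cs ms)) , trans r (++-assoc ms as cs)
... | inj₂ (ms , refl , refl) = ms , ds ++ bs , trans p (++-assoc ms ds bs) , trans r (sym (++-assoc ds bs ms))

rotation⇒↭ : ∀ {xs ys : List A} → Rotation xs ys → xs ↭ ys
rotation⇒↭ (as , bs , refl , refl) = ++-comm as bs

rotation-map : ∀ (f : A → B) {xs ys} → Rotation xs ys → Rotation (map f xs) (map f ys)
rotation-map f (as , bs , refl , refl) = map f as , map f bs , map-++ f as bs , map-++ f bs as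

rotation-reverse : ∀ {xs ys : List A} → Rotation xs ys → Rotation (reverse xs) (reverse ys)
rotation-reverse (as , bs , refl , refl) = reverse bs , reverse as , reverse-++ as bs , reverse-++ bs as

unique-resp-↭ : ∀ {xs ys : List A} → xs ↭ ys → Unique xs → Unique ys
unique-resp-↭ p = ↭ₛ.Unique-resp-↭ (setoid _) (↭⇒↭ₛ p)

lastOf : A → List A → A
lastOf x []       = x
lastOf x (y ∷ ys) = lastOf y ys

lastOf-∷ʳ : ∀ (x : A) ys z → lastOf x (ys ++ [ z ]) ≡ z
lastOf-∷ʳ x []       z = refl
lastOf-∷ʳ x (y ∷ ys) z = lastOf-∷ʳ y ys z

lastOf-map : ∀ (f : A → B) x xs → lastOf (f x) (map f xs) ≡ f (lastOf x xs)
lastOf-map f x []       = refl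
lastOf-map f x (y ∷ ys) = lastOf-map f y ys

module _ {R : A → A → Set} where

  LastRelated : List A → A → Set
  LastRelated []       b = ⊤
  LastRelated (a ∷ as) b = R (lastOf a as) b

  lastRelated-∷ʳ : ∀ as z {b} → R z b → LastRelated (as ++ [ z ]) b
  lastRelated-∷ʳ []       z r = r
  lastRelated-∷ʳ (a ∷ as) z r = subst (λ w → R w _) (sym (lastOf-∷ʳ a as z)) r

  linked-++⁺ : ∀ as {b bs} → Linked R as → Linked R (b ∷ bs) → LastRelated as b → Linked R (as ++ b ∷ bs)
  linked-++⁺ []            _        l r = l
  linked-++⁺ (a ∷ [])      _        l r = r ∷ l
  linked-++⁺ (a ∷ a′ ∷ as) (r′ ∷ l′) l r = r′ ∷ linked-++⁺ (a′ ∷ as) l′ l r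

  linked-++-join : ∀ as {b bs} → Linked R (as ++ [ b ]) → Linked R (b ∷ bs) → Linked R (as ++ b ∷ bs)
  linked-++-join []            l       l′ = l′
  linked-++-join (a ∷ [])      (r ∷ l) l′ = r ∷ l′
  linked-++-join (a ∷ a′ ∷ as) (r ∷ l) l′ = r ∷ linked-++-join (a′ ∷ as) l l′

  linked-++⁻ˡ : ∀ as {b bs} → Linked R (as ++ b ∷ bs) → Linked R (as ++ [ b ])
  linked-++⁻ˡ []            l       = [-]
  linked-++⁻ˡ (a ∷ [])      (r ∷ l) = r ∷ [-]
  linked-++⁻ˡ (a ∷ a′ ∷ as) (r ∷ l) = r ∷ linked-++⁻ˡ (a′ ∷ as) l

  linked-++⁻ʳ : ∀ as {b bs} → Linked R (as ++ b ∷ bs) → Linked R (b ∷ bs)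
  linked-++⁻ʳ []            l       = l
  linked-++⁻ʳ (a ∷ [])      (r ∷ l) = l
  linked-++⁻ʳ (a ∷ a′ ∷ as) (r ∷ l) = linked-++⁻ʳ (a′ ∷ as) l

  linked⇒lastRelated : ∀ as {b bs} → Linked R (as ++ b ∷ bs) → LastRelated as b
  linked⇒lastRelated []            l       = tt
  linked⇒lastRelated (a ∷ [])      (r ∷ l) = r
  linked⇒lastRelated (a ∷ a′ ∷ as) (r ∷ l) = linked⇒lastRelated (a′ ∷ as) l

  linked-∷ʳ⁺ : ∀ {x xs z} → Linked R (x ∷ xs) → R (lastOf x xs) z → Linked R (x ∷ xs ++ [ z ])
  linked-∷ʳ⁺ {xs = []}     l        r = r ∷ [-]
  linked-∷ʳ⁺ {xs = y ∷ ys} (r′ ∷ l) r = r′ ∷ linked-∷ʳ⁺ l r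

  linked-∷ʳ⁻ : ∀ {x xs z} → Linked R (x ∷ xs ++ [ z ]) → Linked R (x ∷ xs) × R (lastOf x xs) z
  linked-∷ʳ⁻ {xs = []}     (r ∷ _)  = [-] , r
  linked-∷ʳ⁻ {xs = y ∷ ys} (r′ ∷ l) with linked-∷ʳ⁻ {xs = ys} l
  ... | l′ , r = r′ ∷ l′ , r

  CyclicallyLinked : List A → Set
  CyclicallyLinked []       = ⊥
  CyclicallyLinked (x ∷ xs) = Linked R (x ∷ xs) × R (lastOf x xs) x

  cyclicallyLinked-rotate₁ : ∀ x xs → CyclicallyLinked (x ∷ xs) → CyclicallyLinked (xs ++ [ x ])
  cyclicallyLinked-rotate₁ x []       c            = c
  cyclicallyLinked-rotate₁ x (y ∷ ys) (r′ ∷ l , r) =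
    linked-∷ʳ⁺ l r , subst (λ w → R w y) (sym (lastOf-∷ʳ y ys x)) r′

  cyclicallyLinked-rotate : ∀ as bs → CyclicallyLinked (as ++ bs) → CyclicallyLinked (bs ++ as)
  cyclicallyLinked-rotate []       bs c = subst CyclicallyLinked (sym (++-identityʳ bs)) c
  cyclicallyLinked-rotate (a ∷ as) bs c =
    subst CyclicallyLinked (++-assoc bs [ a ] as)
      (cyclicallyLinked-rotate as (bs ++ [ a ])
        (subst CyclicallyLinked (++-assoc as bs [ a ]) (cyclicallyLinked-rotate₁ a (as ++ bs) c)))

  cyclicallyLinked-rotation : ∀ {xs ys} → Rotation xs ys → CyclicallyLinked xs → CyclicallyLinked ys
  cyclicallyLinked-rotation (as , bs , refl , refl) = cyclicallyLinked-rotate as bs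

linked-reverse : ∀ {R : A → A → Set} ys → Linked R ys → Linked (flip R) (reverse ys)
linked-reverse []           _       = []
linked-reverse (y ∷ [])     _       = [-]
linked-reverse {R = R} (y ∷ z ∷ zs) (r ∷ l) =
  subst (Linked _) (sym (unfold-reverse y (z ∷ zs)))
    (linked-++⁺ (reverse (z ∷ zs)) (linked-reverse (z ∷ zs) l) [-]
      (subst (λ w → LastRelated {R = flip R} w y) (sym (unfold-reverse z zs)) (lastRelated-∷ʳ (reverse zs) z r)))

reverseTail : List A → List A
reverseTail []       = []
reverseTail (x ∷ xs) = x ∷ reverse xs

rotation-reverseTail : ∀ (xs : List A) → Rotation (reverseTail xs) (reverse xs)
rotation-reverseTail []       = rotation-refl []
rotation-reverseTail (x ∷ xs) = [ x ] , reverse xs , refl , unfold-reverse x xs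

cyclicallyLinked-reverseTail : ∀ {R : A → A → Set} xs →
  CyclicallyLinked {R = R} xs → CyclicallyLinked {R = flip R} (reverseTail xs)
cyclicallyLinked-reverseTail (x ∷ xs) (l , r) =
  linked-∷ʳ⁻ (subst (Linked _) reverse-closed (linked-reverse (x ∷ xs ++ [ x ]) (linked-∷ʳ⁺ l r)))
  where
  reverse-closed : reverse (x ∷ xs ++ [ x ]) ≡ x ∷ reverse xs ++ [ x ]
  reverse-closed = trans (unfold-reverse x (xs ++ [ x ])) (cong (_++ [ x ]) (reverse-++ xs [ x ]))

cyclicallyLinked-map : ∀ {R S : A → A → Set} → (∀ {a b} → R a b → S a b) →
  ∀ {xs} → CyclicallyLinked {R = R} xs → CyclicallyLinked {R = S} xs
cyclicallyLinked-map R⇒S {x ∷ xs} (l , r) = Linked.map R⇒S l , R⇒S r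

cyclicallyLinked-map⁺ : ∀ {R : B → B → Set} (f : A → B) {xs} →
  CyclicallyLinked {R = R on f} xs → CyclicallyLinked {R = R} (map f xs)
cyclicallyLinked-map⁺ {R = R} f {x ∷ xs} (l , r) =
  Linked.map⁺ l , subst (λ w → R w (f x)) (sym (lastOf-map f x xs)) r

module _ (s t : A → B) where

  Consecutive : A → A → Set
  Consecutive e f = t e ≡ s f

  targets≡sources-∷ʳ : ∀ x xs z → Linked Consecutive (x ∷ xs) → Consecutive (lastOf x xs) z →
    map t (x ∷ xs) ≡ map s (xs ++ [ z ])
  targets≡sources-∷ʳ x []       z l        r = cong [_] r
  targets≡sources-∷ʳ x (y ∷ ys) z (r′ ∷ l) r = cong₂ _∷_ r′ (targets≡sources-∷ʳ y ys z l r)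

  targets↭sources : ∀ xs → CyclicallyLinked {R = Consecutive} xs → map t xs ↭ map s xs
  targets↭sources (x ∷ xs) (l , r) =
    subst (_↭ map s (x ∷ xs)) (sym (trans (targets≡sources-∷ʳ x xs x l r) (map-++ s xs [ x ])))
      (↭-sym (∷↭∷ʳ (s x) (map s xs)))

-- Simple cycles as cyclic walks

module _ (G : Digraph n) where

  Consecutiveᴳ : Arc G → Arc G → Set
  Consecutiveᴳ = Consecutive (src G) (tgt G)

  CyclicWalk : List (Arc G) → Set
  CyclicWalk = CyclicallyLinked {R = Consecutiveᴳ}

  cyclicWalk : (c : SimpleCycle G) → CyclicWalk (arcList c)
  cyclicWalk c = linked-∷ʳ⁻ (closed c)

  mkCycle : (es : List (Arc G)) → CyclicWalk es → Unique (map (src G) es) → SimpleCycle G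
  mkCycle (e ∷ es) (l , r) u = cycle e es (linked-∷ʳ⁺ l r) u

  arcList-mkCycle : ∀ es w u → arcList (mkCycle es w u) ≡ es
  arcList-mkCycle (e ∷ es) _ _ = refl

  SharesVertex : SimpleCycle G → SimpleCycle G → Set
  SharesVertex c d = ∃[ v ] (v ∈ vertices c × v ∈ vertices d)

drop-++ : ∀ (as bs : List A) → drop (length as) (as ++ bs) ≡ bs
drop-++ []       bs = refl
drop-++ (a ∷ as) bs = drop-++ as bs

take-++ : ∀ (as bs : List A) → take (length as) (as ++ bs) ≡ as
take-++ []       bs = refl
take-++ (a ∷ as) bs = cong (a ∷_) (take-++ as bs)

module _ {G : Digraph n} where

  rotation⇒≈C : ∀ {c d : SimpleCycle G} → Rotation (arcList c) (arcList d) → c ≈C d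
  rotation⇒≈C {c} (as , bs , p , q) = length as ,
    trans q (sym (subst (λ es → drop (length as) es ++ take (length as) es ≡ bs ++ as) (sym p)
      (cong₂ _++_ (drop-++ as bs) (take-++ as bs))))

  ≈C⇒rotation : ∀ {c d : SimpleCycle G} → c ≈C d → Rotation (arcList c) (arcList d)
  ≈C⇒rotation {c} (k , e) = take k (arcList c) , drop k (arcList c) , sym (take++drop≡id k (arcList c)) , e

  ≡⇒≈C : ∀ {c d : SimpleCycle G} → arcList c ≡ arcList d → c ≈C d
  ≡⇒≈C {c} {d} e = rotation⇒≈C {c} {d} (subst (Rotation (arcList c)) e (rotation-refl (arcList c)))

  ≈C-sym : ∀ {c d : SimpleCycle G} → c ≈C d → d ≈C c
  ≈C-sym {c} {d} p = rotation⇒≈C {d} {c} (rotation-sym (≈C⇒rotation {c} {d} p))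

  ≈C-trans : ∀ {c d e : SimpleCycle G} → c ≈C d → d ≈C e → c ≈C e
  ≈C-trans {c} {d} {e} p q =
    rotation⇒≈C {c} {e} (rotation-trans (≈C⇒rotation {c} {d} p) (≈C⇒rotation {d} {e} q))

module _ {G : Digraph n} {H : Digraph m}
  (to : SimpleCycle G → SimpleCycle H) (from : SimpleCycle H → SimpleCycle G) where

  mkφIso : (∀ {c d} → c ≈C d → to c ≈C to d) → (∀ {c d} → c ≈C d → from c ≈C from d) →
    (∀ c → from (to c) ≈C c) → (∀ d → to (from d) ≈C d) →
    (∀ c d → SharesVertex G c d → SharesVertex H (to c) (to d)) →
    (∀ c d → SharesVertex H (to c) (to d) → SharesVertex G c d) → φIso G H
  mkφIso to-cong from-cong from-to to-from shares⁺ shares⁻ = record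
    { to = to ; from = from ; to-cong = to-cong ; from-cong = from-cong ; from-to = from-to ; to-from = to-from
    ; adj-to   = λ c d (c≉d , sh) → (λ tc≈td → c≉d (reflect tc≈td)) , shares⁺ c d sh
    ; adj-from = λ c d (tc≉td , sh) → (λ c≈d → tc≉td (to-cong c≈d)) , shares⁻ c d sh
    }
    where
    reflect : ∀ {c d} → to c ≈C to d → c ≈C d
    reflect {c} {d} tc≈td = ≈C-trans {c = c} {from (to c)} {d} (≈C-sym {c = from (to c)} {c} (from-to c))
      (≈C-trans {c = from (to c)} {from (to d)} {d} (from-cong tc≈td) (from-to d))

-- Reversal

module _ (g : A → B) where

  map-index : ∀ xs → Fin (length xs) → Fin (length (map g xs))
  map-index (x ∷ xs) zero    = zero
  map-index (x ∷ xs) (suc i) = suc (map-index xs i)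

  map-index⁻ : ∀ xs → Fin (length (map g xs)) → Fin (length xs)
  map-index⁻ (x ∷ xs) zero    = zero
  map-index⁻ (x ∷ xs) (suc i) = suc (map-index⁻ xs i)

  lookup-map-index : ∀ xs i → lookup (map g xs) (map-index xs i) ≡ g (lookup xs i)
  lookup-map-index (x ∷ xs) zero    = refl
  lookup-map-index (x ∷ xs) (suc i) = lookup-map-index xs i

  lookup-map-index⁻ : ∀ xs i → lookup (map g xs) i ≡ g (lookup xs (map-index⁻ xs i))
  lookup-map-index⁻ (x ∷ xs) zero    = refl
  lookup-map-index⁻ (x ∷ xs) (suc i) = lookup-map-index⁻ xs i

  map-index⁻∘map-index : ∀ xs i → map-index⁻ xs (map-index xs i) ≡ i
  map-index⁻∘map-index (x ∷ xs) zero    = refl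
  map-index⁻∘map-index (x ∷ xs) (suc i) = cong suc (map-index⁻∘map-index xs i)

  map-index∘map-index⁻ : ∀ xs i → map-index xs (map-index⁻ xs i) ≡ i
  map-index∘map-index⁻ (x ∷ xs) zero    = refl
  map-index∘map-index⁻ (x ∷ xs) (suc i) = cong suc (map-index∘map-index⁻ xs i)

map-reverseTail-inverse : ∀ (f : A → B) (g : B → A) → (∀ x → g (f x) ≡ x) →
  ∀ xs → map g (reverseTail (map f (reverseTail xs))) ≡ xs
map-reverseTail-inverse f g g∘f [] = refl
map-reverseTail-inverse f g g∘f (x ∷ xs) = cong₂ _∷_ (g∘f x) (begin
  map g (reverse (map f (reverse xs)))  ≡⟨ cong (λ ys → map g (reverse ys)) (reverse-map f xs) ⟩
  map g (reverse (reverse (map f xs)))  ≡⟨ cong (map g) (reverse-involutive (map f xs)) ⟩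
  map g (map f xs)                      ≡⟨ map-∘ xs ⟨
  map (λ x → g (f x)) xs                ≡⟨ map-cong g∘f xs ⟩
  map (λ x → x) xs                      ≡⟨ map-id xs ⟩
  xs                                    ∎)
  where open ≡-Reasoning

module Reversal {G H : Digraph n} (f : Arc G → Arc H)
  (src-f : ∀ e → src H (f e) ≡ tgt G e) (tgt-f : ∀ e → tgt H (f e) ≡ src G e) where

  reverseWalk : List (Arc G) → List (Arc H)
  reverseWalk es = map f (reverseTail es)

  sources-reverseWalk : ∀ es → CyclicWalk G es → map (src H) (reverseWalk es) ↭ map (src G) es
  sources-reverseWalk (e ∷ es) w =
    subst (_↭ map (src G) (e ∷ es)) (sym (trans (sym (map-∘ (e ∷ reverse es))) (map-cong src-f (e ∷ reverse es))))
      (↭-trans (prep (tgt G e) (↭.map⁺ (tgt G) (↭-reverse es))) (targets↭sources (src G) (tgt G) (e ∷ es) w))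

  cyclicWalk-reverseWalk : ∀ es → CyclicWalk G es → CyclicWalk H (reverseWalk es)
  cyclicWalk-reverseWalk es w = cyclicallyLinked-map⁺ f
    (cyclicallyLinked-map (λ {a} {b} e → trans (tgt-f a) (trans (sym e) (sym (src-f b))))
      (cyclicallyLinked-reverseTail es w))

  reverseCycle : SimpleCycle G → SimpleCycle H
  reverseCycle c = mkCycle H (reverseWalk (arcList c)) (cyclicWalk-reverseWalk _ (cyclicWalk G c))
    (unique-resp-↭ (↭-sym (sources-reverseWalk _ (cyclicWalk G c))) (simple c))

  arcList-reverseCycle : ∀ c → arcList (reverseCycle c) ≡ reverseWalk (arcList c)
  arcList-reverseCycle c = arcList-mkCycle H (reverseWalk (arcList c)) (cyclicWalk-reverseWalk _ (cyclicWalk G c))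
    (unique-resp-↭ (↭-sym (sources-reverseWalk _ (cyclicWalk G c))) (simple c))

  vertices-reverseCycle : ∀ c → vertices (reverseCycle c) ↭ vertices c
  vertices-reverseCycle c = subst (λ es → map (src H) es ↭ vertices c) (sym (arcList-reverseCycle c))
    (sources-reverseWalk _ (cyclicWalk G c))

  reverseCycle-shares : ∀ c d → SharesVertex G c d → SharesVertex H (reverseCycle c) (reverseCycle d)
  reverseCycle-shares c d (v , v∈c , v∈d) =
    v , ∈-resp-↭ (↭-sym (vertices-reverseCycle c)) v∈c , ∈-resp-↭ (↭-sym (vertices-reverseCycle d)) v∈d

  reverseCycle-shares⁻ : ∀ c d → SharesVertex H (reverseCycle c) (reverseCycle d) → SharesVertex G c d
  reverseCycle-shares⁻ c d (v , v∈c , v∈d) =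
    v , ∈-resp-↭ (vertices-reverseCycle c) v∈c , ∈-resp-↭ (vertices-reverseCycle d) v∈d

  reverseCycle-cong : ∀ {c d} → c ≈C d → reverseCycle c ≈C reverseCycle d
  reverseCycle-cong {c} {d} c≈d = rotation⇒≈C {c = reverseCycle c} {reverseCycle d}
    (subst₂ Rotation (sym (arcList-reverseCycle c)) (sym (arcList-reverseCycle d))
      (rotation-map f (rotation-trans (rotation-reverseTail (arcList c))
        (rotation-trans (rotation-reverse (≈C⇒rotation {c = c} {d} c≈d))
          (rotation-sym (rotation-reverseTail (arcList d)))))))

reversalIso : (G : Digraph n) → φIso G (reverseAll G)
reversalIso G = mkφIso R.reverseCycle R⁻¹.reverseCycle
  (λ {c} {d} → R.reverseCycle-cong {c} {d}) (λ {c} {d} → R⁻¹.reverseCycle-cong {c} {d})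
  R⁻¹∘R R∘R⁻¹ R.reverseCycle-shares R.reverseCycle-shares⁻
  where
  es = arcs G
  module R = Reversal {G = G} {reverseAll G} (map-index swap es)
    (λ e → cong proj₁ (lookup-map-index swap es e)) (λ e → cong proj₂ (lookup-map-index swap es e))
  module R⁻¹ = Reversal {G = reverseAll G} {G} (map-index⁻ swap es)
    (λ e → sym (cong proj₂ (lookup-map-index⁻ swap es e))) (λ e → sym (cong proj₁ (lookup-map-index⁻ swap es e)))

  R⁻¹∘R : ∀ c → R⁻¹.reverseCycle (R.reverseCycle c) ≈C c
  R⁻¹∘R c = ≡⇒≈C {c = R⁻¹.reverseCycle (R.reverseCycle c)} {c} (begin
    arcList (R⁻¹.reverseCycle (R.reverseCycle c))  ≡⟨ R⁻¹.arcList-reverseCycle (R.reverseCycle c) ⟩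
    R⁻¹.reverseWalk (arcList (R.reverseCycle c))   ≡⟨ cong R⁻¹.reverseWalk (R.arcList-reverseCycle c) ⟩
    R⁻¹.reverseWalk (R.reverseWalk (arcList c))    ≡⟨ map-reverseTail-inverse _ _ (map-index⁻∘map-index swap es) _ ⟩
    arcList c                                      ∎)
    where open ≡-Reasoning

  R∘R⁻¹ : ∀ d → R.reverseCycle (R⁻¹.reverseCycle d) ≈C d
  R∘R⁻¹ d = ≡⇒≈C {c = R.reverseCycle (R⁻¹.reverseCycle d)} {d} (begin
    arcList (R.reverseCycle (R⁻¹.reverseCycle d))  ≡⟨ R.arcList-reverseCycle (R⁻¹.reverseCycle d) ⟩
    R.reverseWalk (arcList (R⁻¹.reverseCycle d))   ≡⟨ cong R.reverseWalk (R⁻¹.arcList-reverseCycle d) ⟩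
    R.reverseWalk (R⁻¹.reverseWalk (arcList d))    ≡⟨ map-reverseTail-inverse _ _ (map-index∘map-index⁻ swap es) _ ⟩
    arcList d                                      ∎)
    where open ≡-Reasoning

-- Positions in appended and concatenated lists

module _ {A : Set} where

  ++-indexˡ : ∀ (xs ys : List A) → Fin (length xs) → Fin (length (xs ++ ys))
  ++-indexˡ (x ∷ xs) ys zero    = zero
  ++-indexˡ (x ∷ xs) ys (suc i) = suc (++-indexˡ xs ys i)

  ++-indexʳ : ∀ (xs ys : List A) → Fin (length ys) → Fin (length (xs ++ ys))
  ++-indexʳ []       ys j = j
  ++-indexʳ (x ∷ xs) ys j = suc (++-indexʳ xs ys j)

  data ++-Position (xs ys : List A) : Fin (length (xs ++ ys)) → Set where
    inˡ : ∀ i → ++-Position xs ys (++-indexˡ xs ys i)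
    inʳ : ∀ j → ++-Position xs ys (++-indexʳ xs ys j)

  ++-position : ∀ xs ys k → ++-Position xs ys k
  ++-position []       ys k       = inʳ k
  ++-position (x ∷ xs) ys zero    = inˡ zero
  ++-position (x ∷ xs) ys (suc k) with ++-position xs ys k
  ... | inˡ i = inˡ (suc i)
  ... | inʳ j = inʳ j

  lookup-++-indexˡ : ∀ xs ys i → lookup (xs ++ ys) (++-indexˡ xs ys i) ≡ lookup xs i
  lookup-++-indexˡ (x ∷ xs) ys zero    = refl
  lookup-++-indexˡ (x ∷ xs) ys (suc i) = lookup-++-indexˡ xs ys i

  lookup-++-indexʳ : ∀ xs ys j → lookup (xs ++ ys) (++-indexʳ xs ys j) ≡ lookup ys j
  lookup-++-indexʳ []       ys j = refl
  lookup-++-indexʳ (x ∷ xs) ys j = lookup-++-indexʳ xs ys j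

  ++-indexˡ≢++-indexʳ : ∀ xs ys i j → ++-indexˡ xs ys i ≢ ++-indexʳ xs ys j
  ++-indexˡ≢++-indexʳ (x ∷ xs) ys (suc i) j e = ++-indexˡ≢++-indexʳ xs ys i j (suc-injective e)

  ++-indexˡ-injective : ∀ xs ys {i i′} → ++-indexˡ xs ys i ≡ ++-indexˡ xs ys i′ → i ≡ i′
  ++-indexˡ-injective (x ∷ xs) ys {zero}  {zero}   e = refl
  ++-indexˡ-injective (x ∷ xs) ys {suc i} {suc i′} e = cong suc (++-indexˡ-injective xs ys (suc-injective e))

  ++-indexʳ-injective : ∀ xs ys {j j′} → ++-indexʳ xs ys j ≡ ++-indexʳ xs ys j′ → j ≡ j′
  ++-indexʳ-injective []       ys e = e
  ++-indexʳ-injective (x ∷ xs) ys e = ++-indexʳ-injective xs ys (suc-injective e)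

module _ (f : A → List B) where

  concatMap-index : ∀ xs (i : Fin (length xs)) → Fin (length (f (lookup xs i))) → Fin (length (concatMap f xs))
  concatMap-index (x ∷ xs) zero    j = ++-indexˡ (f x) (concatMap f xs) j
  concatMap-index (x ∷ xs) (suc i) j = ++-indexʳ (f x) (concatMap f xs) (concatMap-index xs i j)

  data concatMap-Position : (xs : List A) → Fin (length (concatMap f xs)) → Set where
    at : ∀ {xs} i j → concatMap-Position xs (concatMap-index xs i j)

  concatMap-position : ∀ xs k → concatMap-Position xs k
  concatMap-position (x ∷ xs) k with ++-position (f x) (concatMap f xs) k
  ... | inˡ j = at zero j
  ... | inʳ k′ with concatMap-position xs k′
  ...   | at i j = at (suc i) j

  lookup-concatMap-index : ∀ xs i j → lookup (concatMap f xs) (concatMap-index xs i j) ≡ lookup (f (lookup xs i)) j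
  lookup-concatMap-index (x ∷ xs) zero    j = lookup-++-indexˡ (f x) (concatMap f xs) j
  lookup-concatMap-index (x ∷ xs) (suc i) j =
    trans (lookup-++-indexʳ (f x) (concatMap f xs) _) (lookup-concatMap-index xs i j)

  concatMap-index-injectiveˡ : ∀ xs {i j i′ j′} → concatMap-index xs i j ≡ concatMap-index xs i′ j′ → i ≡ i′
  concatMap-index-injectiveˡ (x ∷ xs) {zero}  {_} {zero}   e = refl
  concatMap-index-injectiveˡ (x ∷ xs) {zero}  {_} {suc i′} e = ⊥-elim (++-indexˡ≢++-indexʳ _ _ _ _ e)
  concatMap-index-injectiveˡ (x ∷ xs) {suc i} {_} {zero}   e = ⊥-elim (++-indexˡ≢++-indexʳ _ _ _ _ (sym e))
  concatMap-index-injectiveˡ (x ∷ xs) {suc i} {_} {suc i′} e =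
    cong suc (concatMap-index-injectiveˡ xs (++-indexʳ-injective _ _ e))

  concatMap-index-injectiveʳ : ∀ xs i {j j′} → concatMap-index xs i j ≡ concatMap-index xs i j′ → j ≡ j′
  concatMap-index-injectiveʳ (x ∷ xs) zero    e = ++-indexˡ-injective _ _ e
  concatMap-index-injectiveʳ (x ∷ xs) (suc i) e = concatMap-index-injectiveʳ xs i (++-indexʳ-injective _ _ e)

-- Arcs of a jumped graph

module JumpArcs {n : ℕ} (G : Digraph (suc n)) (v : Fin (suc n)) where

  H : Digraph n
  H = jump v G

  private
    Pair = Fin (suc n) × Fin (suc n)
    L = arcs G

    joinAt : Pair → Fin n → List (Fin n × Fin n)
    joinAt y a = map (λ b → (a , b)) (outArc v y)

    joinPair : Pair → Pair → List (Fin n × Fin n)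
    joinPair x y = concatMap (joinAt y) (inArc v x)

    joinFrom : Pair → List (Fin n × Fin n)
    joinFrom x = concatMap (joinPair x) L

    keptArcs = concatMap (keepArc v) L
    joinedArcs = concatMap joinFrom L

  keepArc-index⁻ : ∀ (x : Pair) (j : Fin (length (keepArc v x))) →
    Σ (v ≢ proj₁ x) λ p → Σ (v ≢ proj₂ x) λ q → lookup (keepArc v x) j ≡ (punchOut p , punchOut q)
  keepArc-index⁻ (a , b) j with v ≟ a | v ≟ b | j
  ... | no p  | no q  | zero = p , q , refl

  keepArc-index : ∀ (x : Pair) → v ≢ proj₁ x → v ≢ proj₂ x → Fin (length (keepArc v x))
  keepArc-index (a , b) p q with v ≟ a | v ≟ b
  ... | no _  | no _  = zero
  ... | yes e | _     = ⊥-elim (p e)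
  ... | no _  | yes e = ⊥-elim (q e)

  keepArc-index-unique : ∀ (x : Pair) (j j′ : Fin (length (keepArc v x))) → j ≡ j′
  keepArc-index-unique (a , b) j j′ with v ≟ a | v ≟ b | j | j′
  ... | no _ | no _ | zero | zero = refl

  inArc-index⁻ : ∀ (x : Pair) (j : Fin (length (inArc v x))) →
    Σ (v ≢ proj₁ x) λ p → v ≡ proj₂ x × lookup (inArc v x) j ≡ punchOut p
  inArc-index⁻ (a , b) j with v ≟ a | v ≟ b | j
  ... | no p | yes q | zero = p , q , refl

  inArc-index : ∀ (x : Pair) → v ≢ proj₁ x → v ≡ proj₂ x → Fin (length (inArc v x))
  inArc-index (a , b) p q with v ≟ a | v ≟ b
  ... | no _  | yes _ = zero
  ... | yes e | _     = ⊥-elim (p e)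
  ... | no _  | no e  = ⊥-elim (e q)

  inArc-index-unique : ∀ (x : Pair) (j j′ : Fin (length (inArc v x))) → j ≡ j′
  inArc-index-unique (a , b) j j′ with v ≟ a | v ≟ b | j | j′
  ... | no _ | yes _ | zero | zero = refl

  outArc-index⁻ : ∀ (y : Pair) (j : Fin (length (outArc v y))) →
    Σ (v ≢ proj₂ y) λ q → v ≡ proj₁ y × lookup (outArc v y) j ≡ punchOut q
  outArc-index⁻ (a , b) j with v ≟ a | v ≟ b | j
  ... | yes p | no q | zero = q , p , refl

  outArc-index : ∀ (y : Pair) → v ≡ proj₁ y → v ≢ proj₂ y → Fin (length (outArc v y))
  outArc-index (a , b) p q with v ≟ a | v ≟ b
  ... | yes _ | no _  = zero
  ... | no e  | _     = ⊥-elim (e p)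
  ... | yes _ | yes e = ⊥-elim (q e)

  outArc-index-unique : ∀ (y : Pair) (j j′ : Fin (length (outArc v y))) → j ≡ j′
  outArc-index-unique (a , b) j j′ with v ≟ a | v ≟ b | j | j′
  ... | yes _ | no _ | zero | zero = refl

  private
    pairWith : (x : Arc G) → Fin (length (inArc v (lookup L x))) → Fin n → Fin n × Fin n
    pairWith x i b = (lookup (inArc v (lookup L x)) i , b)

    keptIndex : (e : Arc G) → Fin (length (keepArc v (lookup L e))) → Arc H
    keptIndex e j = ++-indexˡ keptArcs joinedArcs (concatMap-index (keepArc v) L e j)

    joinedIndex : (x y : Arc G) (i : Fin (length (inArc v (lookup L x)))) → Fin (length (outArc v (lookup L y))) → Arc H
    joinedIndex x y i j = ++-indexʳ keptArcs joinedArcs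
      (concatMap-index joinFrom L x (concatMap-index (joinPair (lookup L x)) L y
        (concatMap-index (joinAt (lookup L y)) (inArc v (lookup L x)) i
          (map-index (pairWith x i) (outArc v (lookup L y)) j))))

    data ArcView : Arc H → Set where
      keptView   : ∀ e j → ArcView (keptIndex e j)
      joinedView : ∀ x y i j → ArcView (joinedIndex x y i j)

    arcView : ∀ h → ArcView h
    arcView h with ++-position keptArcs joinedArcs h
    ... | inˡ k with concatMap-position (keepArc v) L k
    ...   | at e j = keptView e j
    arcView h | inʳ k with concatMap-position joinFrom L k
    ... | at x k′ with concatMap-position (joinPair (lookup L x)) L k′
    ...   | at y k″ with concatMap-position (joinAt (lookup L y)) (inArc v (lookup L x)) k″
    ...     | at i k‴ = subst (λ z → ArcView (++-indexʳ keptArcs joinedArcs (concatMap-index joinFrom L x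
                  (concatMap-index (joinPair (lookup L x)) L y
                    (concatMap-index (joinAt (lookup L y)) (inArc v (lookup L x)) i z)))))
                  (map-index∘map-index⁻ (pairWith x i) (outArc v (lookup L y)) k‴)
                  (joinedView x y i (map-index⁻ (pairWith x i) (outArc v (lookup L y)) k‴))

    lookup-keptIndex : ∀ e j → lookup (arcs H) (keptIndex e j) ≡ lookup (keepArc v (lookup L e)) j
    lookup-keptIndex e j = trans (lookup-++-indexˡ keptArcs joinedArcs _) (lookup-concatMap-index (keepArc v) L e j)

    lookup-joinedIndex : ∀ x y i j →
      lookup (arcs H) (joinedIndex x y i j) ≡ (lookup (inArc v (lookup L x)) i , lookup (outArc v (lookup L y)) j)
    lookup-joinedIndex x y i j = begin
      lookup (arcs H) (joinedIndex x y i j)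
        ≡⟨ lookup-++-indexʳ keptArcs joinedArcs _ ⟩
      _ ≡⟨ lookup-concatMap-index joinFrom L x _ ⟩
      _ ≡⟨ lookup-concatMap-index (joinPair (lookup L x)) L y _ ⟩
      _ ≡⟨ lookup-concatMap-index (joinAt (lookup L y)) (inArc v (lookup L x)) i _ ⟩
      _ ≡⟨ lookup-map-index (pairWith x i) (outArc v (lookup L y)) j ⟩
      (lookup (inArc v (lookup L x)) i , lookup (outArc v (lookup L y)) j) ∎
      where open ≡-Reasoning

  src↑ tgt↑ : Arc H → Fin (suc n)
  src↑ h = punchIn v (src H h)
  tgt↑ h = punchIn v (tgt H h)

  private
    src↑-keptIndex : ∀ e j → src↑ (keptIndex e j) ≡ src G e
    src↑-keptIndex e j with keepArc-index⁻ (lookup L e) j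
    ... | p , q , eq = trans (cong (λ z → punchIn v (proj₁ z)) (trans (lookup-keptIndex e j) eq)) (punchIn-punchOut p)

    tgt↑-keptIndex : ∀ e j → tgt↑ (keptIndex e j) ≡ tgt G e
    tgt↑-keptIndex e j with keepArc-index⁻ (lookup L e) j
    ... | p , q , eq = trans (cong (λ z → punchIn v (proj₂ z)) (trans (lookup-keptIndex e j) eq)) (punchIn-punchOut q)

    src↑-joinedIndex : ∀ x y i j → src↑ (joinedIndex x y i j) ≡ src G x
    src↑-joinedIndex x y i j with inArc-index⁻ (lookup L x) i
    ... | p , _ , eq = trans (cong (λ z → punchIn v (proj₁ z)) (lookup-joinedIndex x y i j))
                         (trans (cong (punchIn v) eq) (punchIn-punchOut p))

    tgt↑-joinedIndex : ∀ x y i j → tgt↑ (joinedIndex x y i j) ≡ tgt G y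
    tgt↑-joinedIndex x y i j with outArc-index⁻ (lookup L y) j
    ... | q , _ , eq = trans (cong (λ z → punchIn v (proj₂ z)) (lookup-joinedIndex x y i j))
                         (trans (cong (punchIn v) eq) (punchIn-punchOut q))

  -- Abstract, so that `with v ≟ _` in the compression lemmas does not reach inside.
  abstract
    kept-arc : (e : Arc G) → v ≢ src G e → v ≢ tgt G e → Arc H
    kept-arc e p q = keptIndex e (keepArc-index (lookup L e) p q)

    joined-arc : (x y : Arc G) → v ≢ src G x → v ≡ tgt G x → v ≡ src G y → v ≢ tgt G y → Arc H
    joined-arc x y p q r s = joinedIndex x y (inArc-index (lookup L x) p q) (outArc-index (lookup L y) r s)

  data ArcKind (h : Arc H) : Set where
    kept   : (e : Arc G) (p : v ≢ src G e) (q : v ≢ tgt G e) → h ≡ kept-arc e p q → ArcKind h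
    joined : (x y : Arc G) (p : v ≢ src G x) (q : v ≡ tgt G x) (r : v ≡ src G y) (s : v ≢ tgt G y) →
             h ≡ joined-arc x y p q r s → ArcKind h

  abstract
    arcKind : ∀ h → ArcKind h
    arcKind h with arcView h
    ... | keptView e j with keepArc-index⁻ (lookup L e) j
    ...   | p , q , _ = kept e p q (cong (keptIndex e) (keepArc-index-unique _ j _))
    arcKind h | joinedView x y i j with inArc-index⁻ (lookup L x) i | outArc-index⁻ (lookup L y) j
    ... | p , q , _ | s , r , _ =
      joined x y p q r s (cong₂ (joinedIndex x y) (inArc-index-unique _ i _) (outArc-index-unique _ j _))

    kept-arc-injective : ∀ {e e′ p q p′ q′} → kept-arc e p q ≡ kept-arc e′ p′ q′ → e ≡ e′
    kept-arc-injective eq = concatMap-index-injectiveˡ (keepArc v) L (++-indexˡ-injective keptArcs joinedArcs eq)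

    kept-arc≢joined-arc : ∀ {e x y p q p′ q′ r s} → kept-arc e p q ≢ joined-arc x y p′ q′ r s
    kept-arc≢joined-arc eq = ++-indexˡ≢++-indexʳ keptArcs joinedArcs _ _ eq

    joined-arc-injective : ∀ {x y x′ y′ p q r s p′ q′ r′ s′} →
      joined-arc x y p q r s ≡ joined-arc x′ y′ p′ q′ r′ s′ → x ≡ x′ × y ≡ y′
    joined-arc-injective {x} eq with concatMap-index-injectiveˡ joinFrom L (++-indexʳ-injective keptArcs joinedArcs eq)
    ... | refl = refl , concatMap-index-injectiveˡ (joinPair (lookup L x)) L
                          (concatMap-index-injectiveʳ joinFrom L x (++-indexʳ-injective keptArcs joinedArcs eq))

    kept-arc-irrelevant : ∀ {e p q p′ q′} → kept-arc e p q ≡ kept-arc e p′ q′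
    kept-arc-irrelevant {e} = cong (keptIndex e) (keepArc-index-unique _ _ _)

    joined-arc-irrelevant : ∀ {x y p q r s p′ q′ r′ s′} → joined-arc x y p q r s ≡ joined-arc x y p′ q′ r′ s′
    joined-arc-irrelevant {x} {y} = cong₂ (joinedIndex x y) (inArc-index-unique _ _ _) (outArc-index-unique _ _ _)

    src↑-kept-arc : ∀ e p q → src↑ (kept-arc e p q) ≡ src G e
    src↑-kept-arc e p q = src↑-keptIndex e _

    tgt↑-kept-arc : ∀ e p q → tgt↑ (kept-arc e p q) ≡ tgt G e
    tgt↑-kept-arc e p q = tgt↑-keptIndex e _

    src↑-joined-arc : ∀ x y p q r s → src↑ (joined-arc x y p q r s) ≡ src G x
    src↑-joined-arc x y p q r s = src↑-joinedIndex x y _ _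

    tgt↑-joined-arc : ∀ x y p q r s → tgt↑ (joined-arc x y p q r s) ≡ tgt G y
    tgt↑-joined-arc x y p q r s = tgt↑-joinedIndex x y _ _

-- Jumping

OutArcsInto InArcsFrom : ∀ {n} (G : Digraph n) → Fin n → Fin n → Set
OutArcsInto G v w = ∀ e → v ≡ src G e → tgt G e ≡ w
InArcsFrom  G v w = ∀ e → v ≡ tgt G e → src G e ≡ w

-- Case analysis without with-abstraction, which would also abstract the
-- decisions hidden in the unfolding of `compress` in the goal.
byCases : ∀ {P B : Set} → Dec P → (P → B) → (¬ P → B) → B
byCases (yes p) f _ = f p
byCases (no ¬p) _ g = g ¬p

module Jump {n : ℕ} (G : Digraph (suc n)) (v w : Fin (suc n)) (v≢w : v ≢ w)
  (funnel : OutArcsInto G v w ⊎ InArcsFrom G v w) where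

  open JumpArcs G v

  no-loop-at-v : ∀ e → v ≡ src G e → v ≡ tgt G e → ⊥
  no-loop-at-v e p q = v≢w ([ (λ out → trans q (out e p)) , (λ in′ → trans p (in′ e q)) ]′ funnel)

  Consecutive↑ : Arc H → Arc H → Set
  Consecutive↑ = Consecutive src↑ tgt↑

  expandKind : ∀ {h} → ArcKind h → List (Arc G)
  expandKind (kept e _ _ _)         = [ e ]
  expandKind (joined x y _ _ _ _ _) = x ∷ y ∷ []

  expandArc : Arc H → List (Arc G)
  expandArc h = expandKind (arcKind h)

  expand : List (Arc H) → List (Arc G)
  expand = concatMap expandArc

  expand-∷ʳ : ∀ M h → expand (M ++ [ h ]) ≡ expand M ++ expandArc h
  expand-∷ʳ M h = trans (concatMap-++ expandArc M [ h ]) (cong (expand M ++_) (++-identityʳ (expandArc h)))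

  record Block (h : Arc H) (xs : List (Arc G)) : Set where
    constructor block
    field
      start            : Arc G
      following        : List (Arc G)
      ≡start∷following : xs ≡ start ∷ following
      src-start        : src G start ≡ src↑ h
      tgt-end          : tgt G (lastOf start following) ≡ tgt↑ h
      linked           : Linked (Consecutiveᴳ G) (start ∷ following)

  kindBlock : ∀ {h} (k : ArcKind h) → Block h (expandKind k)
  kindBlock (kept e p q eq) =
    block e [] refl (sym (trans (cong src↑ eq) (src↑-kept-arc e p q)))
                    (sym (trans (cong tgt↑ eq) (tgt↑-kept-arc e p q))) [-]
  kindBlock (joined x y p q r s eq) =
    block x [ y ] refl (sym (trans (cong src↑ eq) (src↑-joined-arc x y p q r s)))
                       (sym (trans (cong tgt↑ eq) (tgt↑-joined-arc x y p q r s))) (trans (sym q) r ∷ [-])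

  blockOf : ∀ h → Block h (expandArc h)
  blockOf h = kindBlock (arcKind h)

  blocks-linked⁺ : ∀ {h h′ xs xs′ ys} → Block h xs → Block h′ xs′ → Consecutive↑ h h′ →
    Linked (Consecutiveᴳ G) (xs′ ++ ys) → Linked (Consecutiveᴳ G) (xs ++ xs′ ++ ys)
  blocks-linked⁺ (block e es refl _ tgt-end l) (block _ _ refl src-start′ _ _) r l′ =
    linked-++⁺ (e ∷ es) l l′ (trans tgt-end (trans r (sym src-start′)))

  blocks-linked⁻ : ∀ {h h′ xs xs′ ys} → Block h xs → Block h′ xs′ →
    Linked (Consecutiveᴳ G) (xs ++ xs′ ++ ys) → Consecutive↑ h h′ × Linked (Consecutiveᴳ G) (xs′ ++ ys)
  blocks-linked⁻ (block e es refl _ tgt-end _) (block _ _ refl src-start′ _ _) l =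
    trans (sym tgt-end) (trans (linked⇒lastRelated (e ∷ es) l) src-start′) , linked-++⁻ʳ (e ∷ es) l

  block-linked : ∀ {h xs} → Block h xs → Linked (Consecutiveᴳ G) (xs ++ [])
  block-linked (block e es refl _ _ l) = subst (Linked _) (sym (++-identityʳ (e ∷ es))) l

  expand-linked⁺ : ∀ M → Linked Consecutive↑ M → Linked (Consecutiveᴳ G) (expand M)
  expand-linked⁺ []           _       = []
  expand-linked⁺ (h ∷ [])     _       = block-linked (blockOf h)
  expand-linked⁺ (h ∷ h′ ∷ M) (r ∷ l) = blocks-linked⁺ (blockOf h) (blockOf h′) r (expand-linked⁺ (h′ ∷ M) l)

  expand-linked⁻ : ∀ M → Linked (Consecutiveᴳ G) (expand M) → Linked Consecutive↑ M
  expand-linked⁻ []           _ = []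
  expand-linked⁻ (h ∷ [])     _ = [-]
  expand-linked⁻ (h ∷ h′ ∷ M) l =
    let r , l′ = blocks-linked⁻ (blockOf h) (blockOf h′) l in r ∷ expand-linked⁻ (h′ ∷ M) l′

  expand-cyclic⁺ : ∀ M → CyclicallyLinked {R = Consecutive↑} M → CyclicWalk G (expand M)
  expand-cyclic⁺ (h ∷ M) (l , r) with blockOf h
  ... | block e es eq _ _ _ = subst (CyclicWalk G) (sym expand≡) (linked-∷ʳ⁻ closed-walk′)
    where
    expand≡ : expand (h ∷ M) ≡ e ∷ (es ++ expand M)
    expand≡ = cong (_++ expand M) eq
    closed-walk : Linked (Consecutiveᴳ G) (expand (h ∷ M) ++ e ∷ es)
    closed-walk = subst (Linked _) (trans (expand-∷ʳ (h ∷ M) h) (cong (expand (h ∷ M) ++_) eq))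
               (expand-linked⁺ (h ∷ M ++ [ h ]) (linked-∷ʳ⁺ l r))
    closed-walk′ : Linked (Consecutiveᴳ G) (e ∷ (es ++ expand M) ++ [ e ])
    closed-walk′ = subst (λ z → Linked _ (z ++ [ e ])) expand≡ (linked-++⁻ˡ (expand (h ∷ M)) closed-walk)

  expand-cyclic⁻ : ∀ M → CyclicWalk G (expand M) → CyclicallyLinked {R = Consecutive↑} M
  expand-cyclic⁻ (h ∷ M) w with blockOf h
  ... | block e es eq _ _ l = linked-∷ʳ⁻ (expand-linked⁻ (h ∷ M ++ [ h ]) closed-walk)
    where
    expand≡ : expand (h ∷ M) ≡ e ∷ (es ++ expand M)
    expand≡ = cong (_++ expand M) eq
    w′ : CyclicWalk G (e ∷ (es ++ expand M))
    w′ = subst (CyclicWalk G) expand≡ w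
    closed-walk : Linked (Consecutiveᴳ G) (expand (h ∷ M ++ [ h ]))
    closed-walk = subst (Linked _) (sym (trans (expand-∷ʳ (h ∷ M) h) (cong (expand (h ∷ M) ++_) eq)))
      (linked-++-join (expand (h ∷ M))
        (subst (λ z → Linked _ (z ++ [ e ])) (sym expand≡) (linked-∷ʳ⁺ (proj₁ w′) (proj₂ w′))) l)

  src↑≢v : ∀ h → src↑ h ≢ v
  src↑≢v h = punchInᵢ≢i v (src H h)

  ∈-sources-expand : ∀ M {u} → u ∈ map src↑ M → u ∈ map (src G) (expand M)
  ∈-sources-expand (h ∷ M) (here refl) with blockOf h
  ... | block e es eq src-start _ _ =
    subst (λ z → src↑ h ∈ map (src G) (z ++ expand M)) (sym eq) (here (sym src-start))
  ∈-sources-expand (h ∷ M) (there m) = subst (_ ∈_) (sym (map-++ (src G) (expandArc h) (expand M)))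
    (∈-++⁺ʳ (map (src G) (expandArc h)) (∈-sources-expand M m))

  sources-expand⊆ : ∀ M {u} → u ∈ map (src G) (expand M) → u ≡ v ⊎ u ∈ map src↑ M
  sources-expand⊆ (h ∷ M) m with arcKind h
  ... | kept e p q eq with m
  ...   | here refl = inj₂ (here (sym (trans (cong src↑ eq) (src↑-kept-arc e p q))))
  ...   | there m′  = map₂ there (sources-expand⊆ M m′)
  sources-expand⊆ (h ∷ M) m | joined x y p q r s eq with m
  ... | here refl         = inj₂ (here (sym (trans (cong src↑ eq) (src↑-joined-arc x y p q r s))))
  ... | there (here refl) = inj₁ (sym r)
  ... | there (there m′)  = map₂ there (sources-expand⊆ M m′)

  unique-sources-expand⁻ : ∀ M → Unique (map (src G) (expand M)) → Unique (map src↑ M)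
  unique-sources-expand⁻ []      _ = []
  unique-sources-expand⁻ (h ∷ M) u with blockOf h
  ... | block e es eq src-start _ _ =
    All.tabulate (λ m src↑h≡ → All.lookup (AllPairs.head u′) (rest-∈ m) (trans src-start src↑h≡))
      ∷ unique-sources-expand⁻ M unique-rest
    where
    u′ : Unique (src G e ∷ map (src G) (es ++ expand M))
    u′ = subst (λ z → Unique (map (src G) (z ++ expand M))) eq u
    split : map (src G) (es ++ expand M) ≡ map (src G) es ++ map (src G) (expand M)
    split = map-++ (src G) es (expand M)
    rest-∈ : ∀ {y} → y ∈ map src↑ M → y ∈ map (src G) (es ++ expand M)
    rest-∈ m = subst (_ ∈_) (sym split) (∈-++⁺ʳ (map (src G) es) (∈-sources-expand M m))
    unique-rest : Unique (map (src G) (expand M))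
    unique-rest = subst Unique (drop-++ (map (src G) es) _)
      (Unique.drop⁺ (length (map (src G) es)) (subst Unique split (AllPairs.tail u′)))

  ∉-sources-expand : ∀ M {u} → u ≢ v → All (u ≢_) (map src↑ M) → All (u ≢_) (map (src G) (expand M))
  ∉-sources-expand M u≢v fresh = All.tabulate λ m u≡ →
    [ (λ ≡v → u≢v (trans u≡ ≡v)) , (λ m′ → All.lookup fresh m′ u≡) ]′ (sources-expand⊆ M m)

  IsJoinedKind : ∀ {h} → ArcKind h → Set
  IsJoinedKind (kept _ _ _ _)         = ⊥
  IsJoinedKind (joined _ _ _ _ _ _ _) = ⊤

  IsJoined : Arc H → Set
  IsJoined h = IsJoinedKind (arcKind h)

  AtMostOneJoined : List (Arc H) → Set
  AtMostOneJoined []      = ⊤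
  AtMostOneJoined (h ∷ M) = (IsJoined h → All (λ h′ → ¬ IsJoined h′) M) × AtMostOneJoined M

  unique-sources-expand⁺ : ∀ M → Unique (map src↑ M) → AtMostOneJoined M →
    Unique (map (src G) (expand M)) × (All (λ h → ¬ IsJoined h) M → v ∉ map (src G) (expand M))
  unique-sources-expand⁺ []      _            _           = [] , λ _ ()
  unique-sources-expand⁺ (h ∷ M) (fresh ∷ u) (only , amo)
    with arcKind h in kind≡ | unique-sources-expand⁺ M u amo
  ... | kept e p q eq | unique , v∉ =
    (∉-sources-expand M (λ e≡v → p (sym e≡v)) (subst (λ z → All (z ≢_) _) src↑h≡ fresh) ∷ unique) ,
    λ { (_ ∷ none) (here v≡) → p v≡ ; (_ ∷ none) (there m) → v∉ none m }
    where
    src↑h≡ : src↑ h ≡ src G e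
    src↑h≡ = trans (cong src↑ eq) (src↑-kept-arc e p q)
  ... | joined x y p q r s eq | unique , v∉ =
    ((λ x≡y → p (trans r (sym x≡y)))
       ∷ ∉-sources-expand M (λ x≡v → p (sym x≡v)) (subst (λ z → All (z ≢_) _) src↑h≡ fresh))
      ∷ All.tabulate (λ m y≡ → v∉ (only tt) (subst (_∈ _) (trans (sym y≡) (sym r)) m)) ∷ unique ,
    λ { (not ∷ _) _ → not (subst IsJoinedKind (sym kind≡) tt) }
    where
    src↑h≡ : src↑ h ≡ src G x
    src↑h≡ = trans (cong src↑ eq) (src↑-joined-arc x y p q r s)

  -- Inverse to `expand` on walks that start and end off v: an arc into v and the arc
  -- out of v after it are merged into one jumped arc, and arcs avoiding v are kept.
  compressLast : ∀ x → Dec (v ≡ src G x) → Dec (v ≡ tgt G x) → List (Arc H)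
  compressLast x (no p) (no q) = [ kept-arc x p q ]
  compressLast x _      _      = []

  compressStep : ∀ x y → Dec (v ≡ src G x) → Dec (v ≡ tgt G x) → Dec (v ≡ src G y) → Dec (v ≡ tgt G y) →
    (afterX afterY : List (Arc H)) → List (Arc H)
  compressStep x y (no p) (yes q) (yes r) (no s) _      afterY = joined-arc x y p q r s ∷ afterY
  compressStep x y (no p) (no q)  _       _      afterX _      = kept-arc x p q ∷ afterX
  compressStep x y _      _       _       _      afterX _      = afterX

  compress : List (Arc G) → List (Arc H)
  compress []           = []
  compress (x ∷ [])     = compressLast x (v ≟ src G x) (v ≟ tgt G x)
  compress (x ∷ y ∷ ys) =
    compressStep x y (v ≟ src G x) (v ≟ tgt G x) (v ≟ src G y) (v ≟ tgt G y) (compress (y ∷ ys)) (compress ys)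

  compress-from-v : ∀ x xs → v ≡ src G x → compress (x ∷ xs) ≡ compress xs
  compress-from-v x []       p with v ≟ src G x | v ≟ tgt G x
  ... | no ¬p | _ = ⊥-elim (¬p p)
  ... | yes _ | _ = refl
  compress-from-v x (y ∷ ys) p with v ≟ src G x | v ≟ tgt G x
  ... | no ¬p | _ = ⊥-elim (¬p p)
  ... | yes _ | _ = refl

  compress-kept : ∀ x xs (p : v ≢ src G x) (q : v ≢ tgt G x) → compress (x ∷ xs) ≡ kept-arc x p q ∷ compress xs
  compress-kept x []       p q with v ≟ src G x | v ≟ tgt G x
  ... | no _  | no _  = cong [_] kept-arc-irrelevant
  ... | yes e | _     = ⊥-elim (p e)
  ... | no _  | yes e = ⊥-elim (q e)
  compress-kept x (y ∷ ys) p q with v ≟ src G x | v ≟ tgt G x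
  ... | no _  | no _  = cong (_∷ compress (y ∷ ys)) kept-arc-irrelevant
  ... | yes e | _     = ⊥-elim (p e)
  ... | no _  | yes e = ⊥-elim (q e)

  compress-joined : ∀ x y ys (p : v ≢ src G x) (q : v ≡ tgt G x) (r : v ≡ src G y) (s : v ≢ tgt G y) →
    compress (x ∷ y ∷ ys) ≡ joined-arc x y p q r s ∷ compress ys
  compress-joined x y ys p q r s with v ≟ src G x | v ≟ tgt G x
  ... | yes e | _    = ⊥-elim (p e)
  ... | no _  | no e = ⊥-elim (e q)
  ... | no _  | yes _ with v ≟ src G y | v ≟ tgt G y
  ...   | yes _ | no _  = cong (_∷ compress ys) joined-arc-irrelevant
  ...   | no e  | _     = ⊥-elim (e r)
  ...   | yes _ | yes e = ⊥-elim (s e)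

  compress-into-v : ∀ x y ys → v ≢ src G x → v ≡ tgt G x → ¬ (v ≡ src G y × v ≢ tgt G y) →
    compress (x ∷ y ∷ ys) ≡ compress (y ∷ ys)
  compress-into-v x y ys p q ¬joinable with v ≟ src G x | v ≟ tgt G x
  ... | yes e | _    = ⊥-elim (p e)
  ... | no _  | no e = ⊥-elim (e q)
  ... | no _  | yes _ with v ≟ src G y | v ≟ tgt G y
  ...   | yes r | no s  = ⊥-elim (¬joinable (r , s))
  ...   | no _  | _     = refl
  ...   | yes _ | yes _ = refl

  expandArc-kept-arc : ∀ e p q → expandArc (kept-arc e p q) ≡ [ e ]
  expandArc-kept-arc e p q with arcKind (kept-arc e p q)
  ... | kept _ _ _ eq             = cong [_] (sym (kept-arc-injective eq))
  ... | joined _ _ _ _ _ _ eq = ⊥-elim (kept-arc≢joined-arc eq)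

  expandArc-joined-arc : ∀ x y p q r s → expandArc (joined-arc x y p q r s) ≡ x ∷ y ∷ []
  expandArc-joined-arc x y p q r s with arcKind (joined-arc x y p q r s)
  ... | kept _ _ _ eq = ⊥-elim (kept-arc≢joined-arc (sym eq))
  ... | joined _ _ _ _ _ _ eq with joined-arc-injective eq
  ...   | refl , refl = refl

  compress-expand : ∀ M → compress (expand M) ≡ M
  compress-expand []      = refl
  compress-expand (h ∷ M) with arcKind h
  ... | kept e p q eq =
    trans (compress-kept e (expand M) p q) (cong₂ _∷_ (sym eq) (compress-expand M))
  ... | joined x y p q r s eq =
    trans (compress-joined x y (expand M) p q r s) (cong₂ _∷_ (sym eq) (compress-expand M))

  StartsOffV EndsOffV : List (Arc G) → Set
  StartsOffV []      = ⊤
  StartsOffV (x ∷ _) = v ≢ src G x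
  EndsOffV []       = ⊤
  EndsOffV (x ∷ xs) = v ≢ tgt G (lastOf x xs)

  Compressible : List (Arc G) → Set
  Compressible xs = StartsOffV xs × Linked (Consecutiveᴳ G) xs × EndsOffV xs

  endsOffV-tail : ∀ x xs → EndsOffV (x ∷ xs) → EndsOffV xs
  endsOffV-tail x []       _   = tt
  endsOffV-tail x (y ∷ ys) off = off

  compressible-tail : ∀ x xs → Linked (Consecutiveᴳ G) (x ∷ xs) → v ≢ tgt G x → EndsOffV (x ∷ xs) →
    Compressible xs
  compressible-tail x []       _       _ _   = tt , [] , tt
  compressible-tail x (y ∷ ys) (r ∷ l) q off = (λ e → q (trans e (sym r))) , l , off

  expand-compress : ∀ xs → Compressible xs → expand (compress xs) ≡ xs
  expand-compress []           _           = refl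
  expand-compress (x ∷ [])     (p , _ , q) =
    trans (cong expand (compress-kept x [] p q)) (cong (_++ []) (expandArc-kept-arc x p q))
  expand-compress (x ∷ y ∷ ys) (p , l@(r ∷ l′) , off) = byCases (v ≟ tgt G x)
    (λ q → byCases (v ≟ tgt G y)
      (λ s → ⊥-elim (no-loop-at-v y (trans q r) s))
      (λ s → trans (cong expand (compress-joined x y ys p q (trans q r) s))
               (cong₂ _++_ (expandArc-joined-arc x y p q (trans q r) s)
                           (expand-compress ys (compressible-tail y ys l′ s off)))))
    (λ q → trans (cong expand (compress-kept x (y ∷ ys) p q))
             (cong₂ _++_ (expandArc-kept-arc x p q)
                         (expand-compress (y ∷ ys) (compressible-tail x (y ∷ ys) l q off))))

  compress-++ : ∀ xs ys → EndsOffV xs → compress (xs ++ ys) ≡ compress xs ++ compress ys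
  compress-++ []       ys _   = refl
  compress-++ (x ∷ []) ys off = byCases (v ≟ src G x)
    (λ p → trans (compress-from-v x ys p) (cong (_++ compress ys) (sym (compress-from-v x [] p))))
    (λ p → trans (compress-kept x ys p off) (cong (_++ compress ys) (sym (compress-kept x [] p off))))
  compress-++ (x ∷ y ∷ ys) zs off = byCases (v ≟ src G x)
    (λ p → via [] (y ∷ ys) (compress-from-v x (y ∷ ys ++ zs) p) (compress-from-v x (y ∷ ys) p)
             (compress-++ (y ∷ ys) zs off))
    (λ p → byCases (v ≟ tgt G x)
      (λ q → byCases (v ≟ src G y ×-dec ¬? (v ≟ tgt G y))
        (λ (r , s) → via [ joined-arc x y p q r s ] ys (compress-joined x y (ys ++ zs) p q r s)
                       (compress-joined x y ys p q r s)
                       (compress-++ ys zs (endsOffV-tail y ys off)))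
        (λ ¬joinable → via [] (y ∷ ys) (compress-into-v x y (ys ++ zs) p q ¬joinable)
                         (compress-into-v x y ys p q ¬joinable)
                         (compress-++ (y ∷ ys) zs off)))
      (λ q → via [ kept-arc x p q ] (y ∷ ys) (compress-kept x (y ∷ ys ++ zs) p q)
             (compress-kept x (y ∷ ys) p q) (compress-++ (y ∷ ys) zs off)))
    where
    via : ∀ emitted rest → compress (x ∷ y ∷ ys ++ zs) ≡ emitted ++ compress (rest ++ zs) →
      compress (x ∷ y ∷ ys) ≡ emitted ++ compress rest → compress (rest ++ zs) ≡ compress rest ++ compress zs →
      compress (x ∷ y ∷ ys ++ zs) ≡ compress (x ∷ y ∷ ys) ++ compress zs
    via emitted rest long short ih = begin
      compress (x ∷ y ∷ ys ++ zs)                ≡⟨ long ⟩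
      emitted ++ compress (rest ++ zs)           ≡⟨ cong (emitted ++_) ih ⟩
      emitted ++ compress rest ++ compress zs    ≡⟨ ++-assoc emitted _ _ ⟨
      (emitted ++ compress rest) ++ compress zs  ≡⟨ cong (_++ compress zs) short ⟨
      compress (x ∷ y ∷ ys) ++ compress zs       ∎
      where open ≡-Reasoning

  rotateOffV : List (Arc G) → List (Arc G)
  rotateOffV []       = []
  rotateOffV (x ∷ xs) with v ≟ src G x
  ... | yes _ = xs ++ [ x ]
  ... | no _  = x ∷ xs

  rotation-rotateOffV : ∀ xs → Rotation xs (rotateOffV xs)
  rotation-rotateOffV []       = rotation-refl []
  rotation-rotateOffV (x ∷ xs) with v ≟ src G x
  ... | yes _ = [ x ] , xs , refl , refl
  ... | no _  = rotation-refl (x ∷ xs)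

  rotateOffV-startsOffV : ∀ xs → CyclicWalk G xs → StartsOffV (rotateOffV xs)
  rotateOffV-startsOffV (x ∷ xs) w with v ≟ src G x
  ... | no p = p
  ... | yes p with xs | w
  ...   | []     | (_ , r)     = ⊥-elim (no-loop-at-v x p (trans p (sym r)))
  ...   | y ∷ ys | (r ∷ _ , _) = λ q → no-loop-at-v x p (trans q (sym r))

  rotateOffV-startsOffV≡ : ∀ xs → StartsOffV xs → rotateOffV xs ≡ xs
  rotateOffV-startsOffV≡ []       _ = refl
  rotateOffV-startsOffV≡ (x ∷ xs) p with v ≟ src G x
  ... | yes q = ⊥-elim (p q)
  ... | no _  = refl

  compressible-cyclicWalk : ∀ xs → CyclicWalk G xs → StartsOffV xs → Compressible xs
  compressible-cyclicWalk (x ∷ xs) (l , r) p = p , l , λ q → p (trans q r)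

  startsOffV-expand : ∀ h M → StartsOffV (expand (h ∷ M))
  startsOffV-expand h M with blockOf h
  ... | block e es eq src-start _ _ =
    subst (λ z → StartsOffV (z ++ expand M)) (sym eq) (λ q → src↑≢v h (trans (sym src-start) (sym q)))

  consecutive↑⇒consecutiveᴴ : ∀ {h h′} → Consecutive↑ h h′ → Consecutiveᴳ H h h′
  consecutive↑⇒consecutiveᴴ = punchIn-injective v _ _

  src↑-map : ∀ M → map src↑ M ≡ map (punchIn v) (map (src H) M)
  src↑-map = map-∘

  tgt↑-map : ∀ M → map tgt↑ M ≡ map (punchIn v) (map (tgt H) M)
  tgt↑-map = map-∘

  jumpWalk : SimpleCycle G → List (Arc H)
  jumpWalk c = compress (rotateOffV (arcList c))

  cyclicWalk-rotateOffV : ∀ c → CyclicWalk G (rotateOffV (arcList c))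
  cyclicWalk-rotateOffV c = cyclicallyLinked-rotation (rotation-rotateOffV (arcList c)) (cyclicWalk G c)

  expand-jumpWalk : ∀ c → expand (jumpWalk c) ≡ rotateOffV (arcList c)
  expand-jumpWalk c = expand-compress _
    (compressible-cyclicWalk _ (cyclicWalk-rotateOffV c) (rotateOffV-startsOffV _ (cyclicWalk G c)))

  cyclicWalk-jumpWalk : ∀ c → CyclicWalk H (jumpWalk c)
  cyclicWalk-jumpWalk c = cyclicallyLinked-map consecutive↑⇒consecutiveᴴ
    (expand-cyclic⁻ (jumpWalk c) (subst (CyclicWalk G) (sym (expand-jumpWalk c)) (cyclicWalk-rotateOffV c)))

  unique-jumpWalk : ∀ c → Unique (map (src H) (jumpWalk c))
  unique-jumpWalk c = Unique.map⁻ (subst Unique (src↑-map (jumpWalk c))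
    (unique-sources-expand⁻ (jumpWalk c) (subst (λ z → Unique (map (src G) z)) (sym (expand-jumpWalk c)) unique-rotated)))
    where
    unique-rotated : Unique (map (src G) (rotateOffV (arcList c)))
    unique-rotated = unique-resp-↭ (↭.map⁺ (src G) (rotation⇒↭ (rotation-rotateOffV (arcList c)))) (simple c)

  jumpCycle : SimpleCycle G → SimpleCycle H
  jumpCycle c = mkCycle H (jumpWalk c) (cyclicWalk-jumpWalk c) (unique-jumpWalk c)

  arcList-jumpCycle : ∀ c → arcList (jumpCycle c) ≡ jumpWalk c
  arcList-jumpCycle c = arcList-mkCycle H (jumpWalk c) (cyclicWalk-jumpWalk c) (unique-jumpWalk c)

  atMostOneJoined : (f : Arc H → Fin (suc n)) → (∀ h → IsJoined h → f h ≡ w) →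
    ∀ M → Unique (map f M) → AtMostOneJoined M
  atMostOneJoined f joined⇒w []      _           = tt
  atMostOneJoined f joined⇒w (h ∷ M) (fresh ∷ u) =
    (λ j → All.map (λ {h′} ≢ j′ → ≢ (trans (joined⇒w h j) (sym (joined⇒w h′ j′)))) (All.map⁻ fresh)) ,
    atMostOneJoined f joined⇒w M u

  joined-tgt↑≡w : OutArcsInto G v w → ∀ h → IsJoined h → tgt↑ h ≡ w
  joined-tgt↑≡w out h j with arcKind h
  ... | joined x y p q r s eq = trans (cong tgt↑ eq) (trans (tgt↑-joined-arc x y p q r s) (out y r))

  joined-src↑≡w : InArcsFrom G v w → ∀ h → IsJoined h → src↑ h ≡ w
  joined-src↑≡w in′ h j with arcKind h
  ... | joined x y p q r s eq = trans (cong src↑ eq) (trans (src↑-joined-arc x y p q r s) (in′ x q))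

  module _ (d : SimpleCycle H) where

    unique-src↑ : Unique (map src↑ (arcList d))
    unique-src↑ = subst Unique (sym (src↑-map (arcList d))) (Unique.map⁺ (punchIn-injective v _ _) (simple d))

    unique-tgt↑ : Unique (map tgt↑ (arcList d))
    unique-tgt↑ = subst Unique (sym (tgt↑-map (arcList d))) (Unique.map⁺ (punchIn-injective v _ _)
      (unique-resp-↭ (↭-sym (targets↭sources (src H) (tgt H) (arcList d) (cyclicWalk H d))) (simple d)))

    atMostOneJoined-arcList : AtMostOneJoined (arcList d)
    atMostOneJoined-arcList =
      [ (λ out → atMostOneJoined tgt↑ (joined-tgt↑≡w out) (arcList d) unique-tgt↑)
      , (λ in′ → atMostOneJoined src↑ (joined-src↑≡w in′) (arcList d) unique-src↑) ]′ funnel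

    cyclicWalk-expand : CyclicWalk G (expand (arcList d))
    cyclicWalk-expand = expand-cyclic⁺ _ (cyclicallyLinked-map (cong (punchIn v)) (cyclicWalk H d))

    unique-expand : Unique (map (src G) (expand (arcList d)))
    unique-expand = proj₁ (unique-sources-expand⁺ (arcList d) unique-src↑ atMostOneJoined-arcList)

  unjumpCycle : SimpleCycle H → SimpleCycle G
  unjumpCycle d = mkCycle G (expand (arcList d)) (cyclicWalk-expand d) (unique-expand d)

  arcList-unjumpCycle : ∀ d → arcList (unjumpCycle d) ≡ expand (arcList d)
  arcList-unjumpCycle d = arcList-mkCycle G (expand (arcList d)) (cyclicWalk-expand d) (unique-expand d)

  endsOffV-cut : ∀ as bs → Compressible (as ++ bs) → Compressible (bs ++ as) → EndsOffV as
  endsOffV-cut []       bs       _             _           = tt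
  endsOffV-cut (a ∷ as) []       (_ , _ , off) _           =
    subst (λ z → v ≢ tgt G (lastOf a z)) (++-identityʳ as) off
  endsOffV-cut (a ∷ as) (b ∷ bs) (_ , l , _)   (p , _ , _) = λ q → p (trans q (linked⇒lastRelated (a ∷ as) l))

  rotation-compress : ∀ {xs ys} → Rotation xs ys → Compressible xs → Compressible ys →
    Rotation (compress xs) (compress ys)
  rotation-compress (as , bs , refl , refl) cx cy =
    compress as , compress bs , compress-++ as bs (endsOffV-cut as bs cx cy) , compress-++ bs as (endsOffV-cut bs as cy cx)

  rotation-expand : ∀ {M M′} → Rotation M M′ → Rotation (expand M) (expand M′)
  rotation-expand (as , bs , refl , refl) =
    expand as , expand bs , concatMap-++ expandArc as bs , concatMap-++ expandArc bs as

  compressible-rotateOffV : ∀ c → Compressible (rotateOffV (arcList c))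
  compressible-rotateOffV c = compressible-cyclicWalk _ (cyclicWalk-rotateOffV c) (rotateOffV-startsOffV _ (cyclicWalk G c))

  jumpCycle-cong : ∀ {c d} → c ≈C d → jumpCycle c ≈C jumpCycle d
  jumpCycle-cong {c} {d} c≈d = rotation⇒≈C {c = jumpCycle c} {jumpCycle d}
    (subst₂ Rotation (sym (arcList-jumpCycle c)) (sym (arcList-jumpCycle d))
      (rotation-compress rotated (compressible-rotateOffV c) (compressible-rotateOffV d)))
    where
    rotated : Rotation (rotateOffV (arcList c)) (rotateOffV (arcList d))
    rotated = rotation-trans (rotation-sym (rotation-rotateOffV (arcList c)))
                (rotation-trans (≈C⇒rotation {c = c} {d} c≈d) (rotation-rotateOffV (arcList d)))

  unjumpCycle-cong : ∀ {d d′} → d ≈C d′ → unjumpCycle d ≈C unjumpCycle d′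
  unjumpCycle-cong {d} {d′} d≈d′ = rotation⇒≈C {c = unjumpCycle d} {unjumpCycle d′}
    (subst₂ Rotation (sym (arcList-unjumpCycle d)) (sym (arcList-unjumpCycle d′))
      (rotation-expand (≈C⇒rotation {c = d} {d′} d≈d′)))

  unjump∘jump : ∀ c → unjumpCycle (jumpCycle c) ≈C c
  unjump∘jump c = rotation⇒≈C {c = unjumpCycle (jumpCycle c)} {c}
    (subst (λ z → Rotation z (arcList c)) (sym arcList≡) (rotation-sym (rotation-rotateOffV (arcList c))))
    where
    arcList≡ : arcList (unjumpCycle (jumpCycle c)) ≡ rotateOffV (arcList c)
    arcList≡ = trans (arcList-unjumpCycle (jumpCycle c))
                 (trans (cong expand (arcList-jumpCycle c)) (expand-jumpWalk c))

  jump∘unjump : ∀ d → jumpCycle (unjumpCycle d) ≈C d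
  jump∘unjump d = ≡⇒≈C {c = jumpCycle (unjumpCycle d)} {d} (begin
    arcList (jumpCycle (unjumpCycle d))
      ≡⟨ arcList-jumpCycle (unjumpCycle d) ⟩
    compress (rotateOffV (arcList (unjumpCycle d)))
      ≡⟨ cong (λ z → compress (rotateOffV z)) (arcList-unjumpCycle d) ⟩
    compress (rotateOffV (expand (arcList d)))
      ≡⟨ cong compress (rotateOffV-startsOffV≡ _ (startsOffV-expand (first d) (rest d))) ⟩
    compress (expand (arcList d))
      ≡⟨ compress-expand (arcList d) ⟩
    arcList d ∎)
    where open ≡-Reasoning

  sources-expand-jumpWalk : ∀ c → map (src G) (expand (jumpWalk c)) ↭ vertices c
  sources-expand-jumpWalk c = subst (λ z → map (src G) z ↭ vertices c) (sym (expand-jumpWalk c))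
    (↭-sym (↭.map⁺ (src G) (rotation⇒↭ (rotation-rotateOffV (arcList c)))))

  ∈-vertices-jumpCycle : ∀ c {u} → u ∈ vertices c → u ≢ v →
    Σ (Fin n) λ z → punchIn v z ≡ u × z ∈ vertices (jumpCycle c)
  ∈-vertices-jumpCycle c {u} u∈ u≢v
    with sources-expand⊆ (jumpWalk c) (∈-resp-↭ (↭-sym (sources-expand-jumpWalk c)) u∈)
  ... | inj₁ u≡v = ⊥-elim (u≢v u≡v)
  ... | inj₂ u∈′ with ∈-map⁻ (punchIn v) (subst (u ∈_) (src↑-map (jumpWalk c)) u∈′)
  ...   | z , z∈ , u≡ = z , sym u≡ , subst (λ es → z ∈ map (src H) es) (sym (arcList-jumpCycle c)) z∈

  ∈-vertices-jumpCycle⁻ : ∀ c {z} → z ∈ vertices (jumpCycle c) → punchIn v z ∈ vertices c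
  ∈-vertices-jumpCycle⁻ c {z} z∈ = ∈-resp-↭ (sources-expand-jumpWalk c)
    (∈-sources-expand (jumpWalk c) (subst (punchIn v z ∈_) (sym (src↑-map (jumpWalk c)))
      (∈-map⁺ (punchIn v) (subst (λ es → z ∈ map (src H) es) (arcList-jumpCycle c) z∈))))

  v∈⇒w∈ : ∀ c → v ∈ vertices c → w ∈ vertices c
  v∈⇒w∈ c v∈ = [ through-out , through-in ]′ funnel
    where
    targets↭ : map (tgt G) (arcList c) ↭ vertices c
    targets↭ = targets↭sources (src G) (tgt G) (arcList c) (cyclicWalk G c)
    through-out : OutArcsInto G v w → w ∈ vertices c
    through-out out with ∈-map⁻ (src G) v∈
    ... | e , e∈ , v≡ = ∈-resp-↭ targets↭ (subst (_∈ map (tgt G) (arcList c)) (out e v≡) (∈-map⁺ (tgt G) e∈))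
    through-in : InArcsFrom G v w → w ∈ vertices c
    through-in in′ with ∈-map⁻ (tgt G) (∈-resp-↭ (↭-sym targets↭) v∈)
    ... | e , e∈ , v≡ = subst (_∈ vertices c) (in′ e v≡) (∈-map⁺ (src G) e∈)

  shared-vertex-off-v : ∀ c d → SharesVertex G c d →
    Σ (Fin (suc n)) λ u → u ≢ v × u ∈ vertices c × u ∈ vertices d
  shared-vertex-off-v c d (u , u∈c , u∈d) with u ≟ v
  ... | no u≢v   = u , u≢v , u∈c , u∈d
  ... | yes refl = w , (λ w≡v → v≢w (sym w≡v)) , v∈⇒w∈ c u∈c , v∈⇒w∈ d u∈d

  jumpCycle-shares : ∀ c d → SharesVertex G c d → SharesVertex H (jumpCycle c) (jumpCycle d)
  jumpCycle-shares c d shared with shared-vertex-off-v c d shared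
  ... | u , u≢v , u∈c , u∈d with ∈-vertices-jumpCycle c u∈c u≢v | ∈-vertices-jumpCycle d u∈d u≢v
  ...   | z , z↑ , z∈ | z′ , z′↑ , z′∈ =
    z , z∈ , subst (_∈ vertices (jumpCycle d)) (punchIn-injective v z′ z (trans z′↑ (sym z↑))) z′∈

  jumpCycle-shares⁻ : ∀ c d → SharesVertex H (jumpCycle c) (jumpCycle d) → SharesVertex G c d
  jumpCycle-shares⁻ c d (z , z∈c , z∈d) =
    punchIn v z , ∈-vertices-jumpCycle⁻ c z∈c , ∈-vertices-jumpCycle⁻ d z∈d

  jumpIso : φIso G H
  jumpIso = mkφIso jumpCycle unjumpCycle
    (λ {c} {d} → jumpCycle-cong {c} {d}) (λ {d} {d′} → unjumpCycle-cong {d} {d′})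
    unjump∘jump jump∘unjump jumpCycle-shares jumpCycle-shares⁻

proposition5 : (n : ℕ) →
    ((G : Digraph n) → φIso G (reverseAll G))
    × ((G : Digraph (suc n)) (v₁ v₂ : Fin (suc n)) → v₁ ≢ v₂ →
        (∀ a b → (a , b) ∈ arcs G → a ≡ v₁ → b ≡ v₂) →
        φIso G (jump v₁ G))
    × ((G : Digraph (suc n)) (v₁ v₂ : Fin (suc n)) → v₁ ≢ v₂ →
        (∀ a b → (a , b) ∈ arcs G → b ≡ v₂ → a ≡ v₁) →
        φIso G (jump v₂ G))
proposition5 n = reversalIso
  , (λ G v₁ v₂ v₁≢v₂ out → Jump.jumpIso G v₁ v₂ v₁≢v₂
       (inj₁ λ e v₁≡ → out (src G e) (tgt G e) (∈-lookup e) (sym v₁≡)))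
  , (λ G v₁ v₂ v₁≢v₂ in′ → Jump.jumpIso G v₂ v₁ (λ v₂≡v₁ → v₁≢v₂ (sym v₂≡v₁))
       (inj₂ λ e v₂≡ → in′ (src G e) (tgt G e) (∈-lookup e) (sym v₂≡)))
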